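{- The class of betweenness frames is not sufficiency axiomatic: there is no set $\Gamma$ of formulas of the binary sufficiency modal language such that a 3-frame $\langle U,B\rangle$ validates every formula of $\Gamma$ if and only if $\langle U,B\rangle$ is a betweenness frame.
   Context: A 3-frame is a pair $\langle U,B\rangle$ with $U$ non-empty and $B\subseteq U^3$. It is a betweenness frame if for all $a,b,c\in U$: (BT0) $B(a,a,a)$; (BT1) $B(a,b,c)\rightarrow B(c,b,a)$; (BT2) $B(a,b,c)\rightarrow B(a,a,b)$; (BT3) $B(a,b,c)\wedge B(a,c,b)\rightarrow b=c$. Formulas of the binary sufficiency modal language are built from propositional variables with the Boolean connectives and one binary operator $[\![\cdot,\cdot]\!]$. In a model on $\langle U,B\rangle$ (a valuation assigning subsets of $U$ to variables), Boolean connectives are interpreted classically and $x\Vdash[\![\varphi,\psi]\!]$ iff for all $y,z\in U$ with $y\Vdash\varphi$ and $z\Vdash\psi$ we have $B(y,x,z)$. A frame validates a formula if the formula is true at every point under every valuation. -}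

module Defs where

open import Data.Nat using (ℕ)
open import Data.Empty using (⊥)
open import Data.Unit using (⊤)
open import Data.Product using (_×_; Σ)
open import Data.Sum using (_⊎_)
open import Relation.Nullary using (¬_)
open import Relation.Binary.PropositionalEquality using (_≡_)

record Frame : Set₁ where
  field
    U        : Set
    inhabited : U
    B        : U → U → U → Set
open Frame public

record IsBetweenness (F : Frame) : Set where
  field
    bt0 : ∀ (a : U F) → B F a a a
    bt1 : ∀ {a b c : U F} → B F a b c → B F c b a
    bt2 : ∀ {a b c : U F} → B F a b c → B F a a b
    bt3 : ∀ {a b c : U F} → B F a b c → B F a c b → b ≡ c

infixr 6 _∧'_
infixr 5 _∨'_
infixr 4 _⇒'_
data Formula : Set where
  var   : ℕ → Formula
  ⊤'    : Formula
  ⊥'    : Formula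
  ¬'_   : Formula → Formula
  _∧'_  : Formula → Formula → Formula
  _∨'_  : Formula → Formula → Formula
  _⇒'_  : Formula → Formula → Formula
  ⟦_,_⟧ : Formula → Formula → Formula

Valuation : Frame → Set₁
Valuation F = ℕ → U F → Set

_,_,_⊩_ : (F : Frame) → Valuation F → U F → Formula → Set
F , V , x ⊩ var p     = V p x
F , V , x ⊩ ⊤'        = ⊤
F , V , x ⊩ ⊥'        = ⊥
F , V , x ⊩ (¬' φ)    = ¬ (F , V , x ⊩ φ)
F , V , x ⊩ (φ ∧' ψ)  = (F , V , x ⊩ φ) × (F , V , x ⊩ ψ)
F , V , x ⊩ (φ ∨' ψ)  = (F , V , x ⊩ φ) ⊎ (F , V , x ⊩ ψ)
F , V , x ⊩ (φ ⇒' ψ)  = (F , V , x ⊩ φ) → (F , V , x ⊩ ψ)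
F , V , x ⊩ ⟦ φ , ψ ⟧ =
  ∀ y z → F , V , y ⊩ φ → F , V , z ⊩ ψ → B F y x z

_⊨_ : Frame → Formula → Set₁
F ⊨ φ = ∀ (V : Valuation F) (x : U F) → F , V , x ⊩ φ

_⊨Γ_ : Frame → (Formula → Set) → Set₁
F ⊨Γ Γ = ∀ φ → Γ φ → F ⊨ φ

SufficiencyAxiomatic : (Frame → Set) → Set₁
SufficiencyAxiomatic K =
  Σ (Formula → Set) λ Γ → ∀ (F : Frame) → ((F ⊨Γ Γ → K F) × (K F → F ⊨Γ Γ))

{-# OPTIONS --safe #-}
module Submission where

-- In a frame whose relation B holds of every triple, every formula ⟦ φ , ψ ⟧ is
-- true everywhere, so the truth of any formula at a point depends only on the
-- atoms true there. Hence all such "full" frames validate the same formulas,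
-- whatever their size. The one-point full frame is a betweenness frame, while
-- the two-point one violates BT3; no set of formulas can separate them.

open import Defs
open import Data.Bool using (Bool; true; false)
open import Data.Product using (_,_; proj₁; proj₂)
open import Data.Sum using (inj₁; inj₂)
open import Data.Empty using (⊥)
open import Data.Unit using (⊤; tt)
open import Function using (_⇔_; mk⇔; Equivalence)
open import Function.Construct.Identity using (⇔-id)
open import Relation.Nullary using (¬_)
open import Relation.Binary.PropositionalEquality using (refl)

open Equivalence using (to; from)

Full : Frame → Set
Full F = ∀ a b c → B F a b c

fullFrame : (A : Set) → A → Frame
fullFrame A a = record { U = A ; inhabited = a ; B = λ _ _ _ → ⊤ }

fullFrame-full : ∀ A a → Full (fullFrame A a)
fullFrame-full _ _ _ _ _ = tt

full-⊩-determinedByAtoms : ∀ {F G : Frame} → Full F → Full G →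
  ∀ (V : Valuation F) (W : Valuation G) x y → (∀ p → V p x ⇔ W p y) →
  ∀ φ → (F , V , x ⊩ φ) ⇔ (G , W , y ⊩ φ)
full-⊩-determinedByAtoms {F} {G} fF fG V W x y atoms = go
  where
  go : ∀ φ → (F , V , x ⊩ φ) ⇔ (G , W , y ⊩ φ)
  go (var p)   = atoms p
  go ⊤'        = ⇔-id ⊤
  go ⊥'        = ⇔-id ⊥
  go (¬' φ)    = mk⇔ (λ h k → h (from (go φ) k)) (λ h k → h (to (go φ) k))
  go (φ ∧' ψ)  = mk⇔ (λ { (a , b) → to (go φ) a , to (go ψ) b })
                     (λ { (a , b) → from (go φ) a , from (go ψ) b })
  go (φ ∨' ψ)  = mk⇔ (λ { (inj₁ a) → inj₁ (to (go φ) a) ; (inj₂ b) → inj₂ (to (go ψ) b) })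
                     (λ { (inj₁ a) → inj₁ (from (go φ) a) ; (inj₂ b) → inj₂ (from (go ψ) b) })
  go (φ ⇒' ψ)  = mk⇔ (λ h a → to (go ψ) (h (from (go φ) a)))
                     (λ h a → from (go ψ) (h (to (go φ) a)))
  go ⟦ φ , ψ ⟧ = mk⇔ (λ _ _ z _ _ → fG _ y z) (λ _ _ z _ _ → fF _ x z)

⊨-full-transfer : ∀ {F G} → Full F → Full G → ∀ φ → F ⊨ φ → G ⊨ φ
⊨-full-transfer {F} fF fG φ Fφ W y =
  to (full-⊩-determinedByAtoms fF fG V W (inhabited F) y (λ p → ⇔-id (W p y)) φ)
     (Fφ V (inhabited F))
  where
  V : Valuation F
  V p _ = W p y

⊨Γ-full-transfer : ∀ {F G} → Full F → Full G → ∀ {Γ} → F ⊨Γ Γ → G ⊨Γ Γ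
⊨Γ-full-transfer fF fG FΓ φ γ = ⊨-full-transfer fF fG φ (FΓ φ γ)

point : Frame
point = fullFrame ⊤ tt

point-isBetweenness : IsBetweenness point
point-isBetweenness = record
  { bt0 = λ _ → tt ; bt1 = λ _ → tt ; bt2 = λ _ → tt ; bt3 = λ _ _ → refl }

twoPoints : Frame
twoPoints = fullFrame Bool true

twoPoints-¬isBetweenness : ¬ IsBetweenness twoPoints
twoPoints-¬isBetweenness b with IsBetweenness.bt3 b {true} {true} {false} tt tt
... | ()

theorem4p8 : ¬ SufficiencyAxiomatic IsBetweenness
theorem4p8 (Γ , defines) = twoPoints-¬isBetweenness (proj₁ (defines twoPoints) twoPoints⊨Γ)
  where
  twoPoints⊨Γ : twoPoints ⊨Γ Γ
  twoPoints⊨Γ = ⊨Γ-full-transfer (fullFrame-full ⊤ tt) (fullFrame-full Bool true)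
                  (proj₂ (defines point) point-isBetweenness)
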